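{- Let $k\ge0$, let $\mathcal{M} = ((W, R, V), w_d)$ be a pointed model with rooted $k$-contraction $\mathcal{M}'=((W', R', V'), w'_d)$, and let $x \in \mathrm{Max}(W)$. Then the bound of $x$ in $\mathcal{M}$ equals the bound of the world $[x]_{b(x)}$ in $\mathcal{M}'$.
   Context: Fix a countable set $\mathcal{P}$ of atomic propositions and a finite set $\mathcal{I}$ of modality indices. A model is $M=(W,R,V)$ with $W$ finite nonempty, $R_i\subseteq W\times W$ for $i\in\mathcal{I}$, $V:\mathcal{P}\to2^W$; a pointed model is $(M,w_d)$ with $w_d\in W$. $\sim_h$ denotes standard $h$-bounded bisimilarity; for worlds of one model, $w\sim_hv$ means $(M,w)\sim_h(M,v)$, and $[w]_h=\{v\in W\mid w\sim_hv\}$. For any pointed model and the fixed $k$: depth $d(w)$ = length of a shortest path from the designated world to $w$ along edges of any $R_i$ ($\infty$ if none); bound $b(w)=k-d(w)$ (computed in the pointed model to which $w$ belongs). For $x,y$ with nonnegative bound, $x\succ y$ iff $b(x)>b(y)$ and $x\sim_{b(y)}y$. $\mathrm{Max}(W)=\{x\in W\mid b(x)\ge0$ and no $y\in W$ has $y\succ x\}$. The rooted $k$-contraction of $\mathcal{M}$ is $((W',R',V'),[w_d]_{b(w_d)})$ with $W'=\{[x]_{b(x)}\mid x\in\mathrm{Max}(W)\}$, $R'_i=\{([x]_{b(x)},[y]_{b(y)})\mid x,y\in\mathrm{Max}(W),\ \exists z\,(xR_iz\text{ and }y\sim_{b(x)-1}z),\ b(x)>0\}$, $V'(p)=\{[x]_{b(x)}\mid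 x\in\mathrm{Max}(W),\ x\in V(p)\}$ (bounds here taken in $\mathcal{M}$). -}

module Defs where

open import Level using (Level; _⊔_; 0ℓ) renaming (suc to lsuc)
open import Data.Nat using (ℕ; zero; suc; _+_; _∸_; _<_; _>_; z≤n; s≤s)
open import Data.Nat.Properties using (m≤n+m; <⇒≱)
open import Data.Fin using (Fin)
open import Data.Product using (Σ; ∃; ∃-syntax; _×_; _,_)
open import Relation.Binary.PropositionalEquality using (_≡_; refl; subst)
open import Relation.Nullary using (¬_)
open import Function.Bundles using (_⇔_)
open import Function.Construct.Identity using (⇔-id)

-- A model carries an equality _≈_ on worlds (propositional equality for
-- ordinary finite models; extensional set equality for the contraction,
-- whose worlds are sets of worlds).
record Model (ni : ℕ) (a b : Level) : Set (lsuc (a ⊔ b)) where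
  field
    W   : Set a
    _≈_ : W → W → Set b
    R   : Fin ni → W → W → Set b
    V   : ℕ → W → Set b

open Model public

record Pointed (ni : ℕ) (a b : Level) : Set (lsuc (a ⊔ b)) where
  field
    model : Model ni a b
    root  : W model

open Pointed public

finModel : ∀ {ni n} → (Fin ni → Fin n → Fin n → Set) → (ℕ → Fin n → Set) → Model ni 0ℓ 0ℓ
finModel {n = n} R V = record { W = Fin n ; _≈_ = _≡_ ; R = R ; V = V }

finPointed : ∀ {ni n} → (Fin ni → Fin n → Fin n → Set) → (ℕ → Fin n → Set) → Fin n → Pointed ni 0ℓ 0ℓ
finPointed R V wd = record { model = finModel R V ; root = wd }

Bisim : ∀ {ni a b c d} → ℕ → (M : Model ni a b) → W M → (N : Model ni c d) → W N → Set (a ⊔ b ⊔ c ⊔ d)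
Bisim {a = a} {c = c} zero M w N v = Level.Lift (a ⊔ c) (∀ p → V M p w ⇔ V N p v)
Bisim {a = a} {c = c} (suc h) M w N v =
  Level.Lift (a ⊔ c) (∀ p → V M p w ⇔ V N p v)
  × (∀ i w' → R M i w w' → ∃[ v' ] (R N i v v' × Bisim h M w' N v'))
  × (∀ i v' → R N i v v' → ∃[ w' ] (R M i w w' × Bisim h M w' N v'))

Path : ∀ {ni} {a b} (M : Model ni a b) → W M → W M → ℕ → Set (a ⊔ b)
Path {a = a} M u v zero    = Level.Lift a (_≈_ M u v)
Path M u v (suc n) = ∃[ i ] ∃[ z ] (R M i u z × Path M z v n)

IsDepth : ∀ {ni a b} (P : Pointed ni a b) → W (model P) → ℕ → Set (a ⊔ b)
IsDepth P w d = Path (model P) (root P) w d × (∀ m → m < d → ¬ Path (model P) (root P) w m)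

-- HasBound k P w b : the bound b(w) = k - d(w) equals the NONNEGATIVE integer b
HasBound : ∀ {ni a b} → ℕ → (P : Pointed ni a b) → W (model P) → ℕ → Set (a ⊔ b)
HasBound k P w b = ∃[ d ] (IsDepth P w d × d + b ≡ k)

Succ : ∀ {ni a b} → ℕ → (P : Pointed ni a b) → W (model P) → W (model P) → Set (a ⊔ b)
Succ k P y x = ∃[ by ] ∃[ bx ] (HasBound k P y by × HasBound k P x bx × by > bx
                                  × Bisim bx (model P) y (model P) x)

InMax : ∀ {ni a b} → ℕ → (P : Pointed ni a b) → W (model P) → ℕ → Set (a ⊔ b)
InMax k P x b = HasBound k P x b × (∀ y → ¬ Succ k P y x)

Class : ∀ {ni a b} → (M : Model ni a b) → ℕ → W M → W M → Set (a ⊔ b)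
Class M h x v = Bisim h M x M v

SameSet : ∀ {n} → (Fin n → Set) → (Fin n → Set) → Set
SameSet C D = ∀ v → C v ⇔ D v

module Contraction {ni n : ℕ} (k : ℕ) (R₀ : Fin ni → Fin n → Fin n → Set)
                   (V₀ : ℕ → Fin n → Set) (wd : Fin n) where

  M : Model ni 0ℓ 0ℓ
  M = finModel R₀ V₀

  P : Pointed ni 0ℓ 0ℓ
  P = finPointed R₀ V₀ wd

  IsMaxClass : (Fin n → Set) → Set
  IsMaxClass C = ∃[ x ] ∃[ bx ] (InMax k P x bx × SameSet C (Class M bx x))

  W' : Set₁
  W' = Σ (Fin n → Set) IsMaxClass

  _≈'_ : W' → W' → Set
  (C , _) ≈' (D , _) = SameSet C D

  R' : Fin ni → W' → W' → Set
  R' i (C , _) (D , _) =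
    ∃[ x ] ∃[ bx ] ∃[ y ] ∃[ by ]
      (InMax k P x bx × InMax k P y by
       × SameSet C (Class M bx x) × SameSet D (Class M by y)
       × ∃[ z ] (R₀ i x z × Bisim (bx ∸ 1) M y M z)
       × bx > 0)

  V' : ℕ → W' → Set
  V' p (C , _) = ∃[ x ] ∃[ bx ] (InMax k P x bx × SameSet C (Class M bx x) × V₀ p x)

  classOf : (x : Fin n) (bx : ℕ) → InMax k P x bx → W'
  classOf x bx mx = Class M bx x , x , bx , mx , λ v → ⇔-id _

  root-max : InMax k P wd k
  root-max = (0 , (Level.lift refl , λ m ()) , refl) , noSucc
    where
      noSucc : ∀ y → ¬ Succ k P y wd
      noSucc y (by , bx , (d , _ , eq) , (zero , _ , refl) , gt , _) =
        <⇒≱ gt (subst (λ t → by Data.Nat.≤ t) eq (m≤n+m by d))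
      noSucc y (by , bx , _ , (suc d' , (_ , min) , _) , _ , _) =
        min 0 (s≤s z≤n) (Level.lift refl)

  contraction : Pointed ni (lsuc 0ℓ) 0ℓ
  contraction = record
    { model = record { W = W' ; _≈_ = _≈'_ ; R = R' ; V = V' }
    ; root  = classOf wd k root-max }

{-# OPTIONS --safe #-}
-- The depth of [x] is at most d(x): if a world on a shortest path to x were dominated, the dominating
-- world would, via the back condition, have a successor dominating the next world, and so on up to x;
-- hence every world of the path lies in Max(W) and consecutive classes are R'-related. It is at least
-- d(x): along an R'-edge the bound of the maximal representative drops by at most one, for otherwise
-- the R-successor witnessing the edge would dominate the representative of the target class.
module Submission where

open import Defs
open import Data.Nat using (ℕ)
open import Data.Fin using (Fin)

open import Level using (Level; lift; 0ℓ) renaming (suc to lsuc)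
open import Data.Nat using (zero; suc; _+_; _∸_; _≤_; _<_; z≤n; s≤s)
open import Data.Nat.Properties
open import Data.Nat.Induction using (<-rec)
open import Data.Product using (∃-syntax; _×_; _,_; proj₁)
open import Relation.Nullary using (¬_; contradiction)
open import Relation.Binary.Definitions using (tri<; tri≈; tri>)
open import Relation.Binary.PropositionalEquality using (_≡_; refl; sym; trans)
open import Function.Bundles using (module Equivalence)
open import Function.Construct.Identity using (⇔-id)
open import Function.Construct.Symmetry using (⇔-sym)
open import Function.Construct.Composition using (_⇔-∘_)

open Equivalence using (to; from)

private variable
  ni : ℕ
  ℓ₁ ℓ₂ ℓ₃ ℓ₄ : Level

Bisim-refl : ∀ {M : Model ni ℓ₁ ℓ₂} h w → Bisim h M w M w
Bisim-refl zero    w = lift λ _ → ⇔-id _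
Bisim-refl (suc h) w =
  lift (λ _ → ⇔-id _) , (λ i w′ r → w′ , r , Bisim-refl h w′) , (λ i w′ r → w′ , r , Bisim-refl h w′)

Bisim-sym : ∀ {M : Model ni ℓ₁ ℓ₂} {N : Model ni ℓ₃ ℓ₄} h {w v} → Bisim h M w N v → Bisim h N v M w
Bisim-sym zero    (lift V⇔) = lift λ p → ⇔-sym (V⇔ p)
Bisim-sym (suc h) (lift V⇔ , forth , back) =
  lift (λ p → ⇔-sym (V⇔ p))
  , (λ i v′ r → let w′ , r′ , w′∼v′ = back i v′ r  in w′ , r′ , Bisim-sym h w′∼v′)
  , (λ i w′ r → let v′ , r′ , w′∼v′ = forth i w′ r in v′ , r′ , Bisim-sym h w′∼v′)

Bisim-mono : ∀ {M : Model ni ℓ₁ ℓ₂} {N : Model ni ℓ₃ ℓ₄} {h′ h w v} →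
             h′ ≤ h → Bisim h M w N v → Bisim h′ M w N v
Bisim-mono {h′ = zero} {zero}  _ w∼v             = w∼v
Bisim-mono {h′ = zero} {suc h} _ (V⇔ , _)        = V⇔
Bisim-mono {h′ = suc h′} {suc h} (s≤s h′≤h) (V⇔ , forth , back) =
  V⇔
  , (λ i w′ r → let v′ , r′ , w′∼v′ = forth i w′ r in v′ , r′ , Bisim-mono h′≤h w′∼v′)
  , (λ i v′ r → let w′ , r′ , w′∼v′ = back i v′ r  in w′ , r′ , Bisim-mono h′≤h w′∼v′)

path-snoc : ∀ {M : Model ni ℓ₁ ℓ₂} →
            (∀ {u} → _≈_ M u u) → (∀ {i u v w} → _≈_ M u v → R M i v w → R M i u w) →
            ∀ {u v w i} m → Path M u v m → R M i v w → Path M u w (suc m)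
path-snoc ≈-refl ≈-resp zero    (lift u≈v)      r = _ , _ , ≈-resp u≈v r , lift ≈-refl
path-snoc ≈-refl ≈-resp (suc m) (j , z , r′ , p) r = j , z , r′ , path-snoc ≈-refl ≈-resp m p r

-- Paths are not decidable (the relations are arbitrary), so a shortest path exists only
-- up to double negation.
¬¬-depth≤ : ∀ {P : Pointed ni ℓ₁ ℓ₂} {w} L → Path (model P) (root P) w L →
            ¬ ¬ (∃[ D ] (D ≤ L × IsDepth P w D))
¬¬-depth≤ {P = P} {w} = <-rec _ step
  where
    step : ∀ L → (∀ {L′} → L′ < L → Path (model P) (root P) w L′ →
                               ¬ ¬ (∃[ D ] (D ≤ L′ × IsDepth P w D))) →
           Path (model P) (root P) w L → ¬ ¬ (∃[ D ] (D ≤ L × IsDepth P w D))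
    step L shorter p noDepth = noDepth (L , ≤-refl , p , λ L′ L′<L q →
      shorter L′<L q λ (D , D≤L′ , depth) → noDepth (D , ≤-trans D≤L′ (<⇒≤ L′<L) , depth))

depth-unique : ∀ {P : Pointed ni ℓ₁ ℓ₂} {w d₁ d₂} → IsDepth P w d₁ → IsDepth P w d₂ → d₁ ≡ d₂
depth-unique {d₁ = d₁} {d₂} (p₁ , shortest₁) (p₂ , shortest₂) with <-cmp d₁ d₂
... | tri< d₁<d₂ _ _ = contradiction p₁ (shortest₂ d₁ d₁<d₂)
... | tri≈ _ d₁≡d₂ _ = d₁≡d₂
... | tri> _ _ d₂<d₁ = contradiction p₂ (shortest₁ d₂ d₂<d₁)

bound-unique : ∀ {P : Pointed ni ℓ₁ ℓ₂} {k w b₁ b₂} → HasBound k P w b₁ → HasBound k P w b₂ → b₁ ≡ b₂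
bound-unique {b₁ = b₁} {b₂} (d₁ , depth₁ , e₁) (d₂ , depth₂ , e₂) with depth-unique depth₁ depth₂
... | refl = +-cancelˡ-≡ d₁ b₁ b₂ (trans e₁ (sym e₂))

private
  ≤-after-step : ∀ {d b k D} → d + suc b ≡ k → D ≤ suc d → b + D ≤ k
  ≤-after-step {d} {b} {k} {D} e D≤1+d = begin
    b + D      ≤⟨ +-monoʳ-≤ b D≤1+d ⟩
    b + suc d  ≡⟨ +-comm b (suc d) ⟩
    suc d + b  ≡⟨ +-suc d b ⟨
    d + suc b  ≡⟨ e ⟩
    k          ∎
    where open ≤-Reasoning

  depth≤ : ∀ {d b k m} → d + b ≡ k → k ≤ b + m → d ≤ m
  depth≤ {d} {b} {k} {m} e k≤b+m = +-cancelʳ-≤ b d m (begin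
    d + b  ≡⟨ e ⟩
    k      ≤⟨ k≤b+m ⟩
    b + m  ≡⟨ +-comm b m ⟩
    m + b  ∎)
    where open ≤-Reasoning

module MaxWorlds {ni n : ℕ} (k : ℕ) (R₀ : Fin ni → Fin n → Fin n → Set)
                 (V₀ : ℕ → Fin n → Set) (wd : Fin n) where
  open Contraction k R₀ V₀ wd using (M; P)

  Undominated : Fin n → Set
  Undominated x = ∀ y → ¬ Succ k P y x

  path-snocᴹ : ∀ {u v w i} m → Path M u v m → R₀ i v w → Path M u w (suc m)
  path-snocᴹ = path-snoc {M = M} refl λ { refl r → r }

  path-unsnocᴹ : ∀ {u w} m → Path M u w (suc m) → ∃[ v ] ∃[ i ] (Path M u v m × R₀ i v w)
  path-unsnocᴹ zero    (i , _ , r , lift refl) = _ , i , lift refl , r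
  path-unsnocᴹ (suc m) (i , z , r , p) =
    let v , j , p′ , r′ = path-unsnocᴹ m p in v , j , (i , z , r , p′) , r′

  ≻-intro : ∀ {x bx y by h} → HasBound k P y by → HasBound k P x bx → bx < by →
            Bisim h M y M x → bx ≤ h → Succ k P y x
  ≻-intro hy hx bx<by y∼x bx≤h = _ , _ , hy , hx , bx<by , Bisim-mono bx≤h y∼x

  ¬¬-bound-after-step : ∀ {u z i bu} → HasBound k P u (suc bu) → R₀ i u z →
                        ¬ ¬ (∃[ bz ] (HasBound k P z bz × bu ≤ bz))
  ¬¬-bound-after-step {bu = bu} (du , (pu , _) , e) r noBound =
    ¬¬-depth≤ (suc du) (path-snocᴹ du pu r) λ (D , D≤1+du , depth) →
      let bu+D≤k = ≤-after-step e D≤1+du in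
      noBound (k ∸ D , (D , depth , m+[n∸m]≡n (m+n≤o⇒n≤o bu bu+D≤k)) , m+n≤o⇒m≤o∸n bu bu+D≤k)

  undominated-pred : ∀ {u z i bz} → HasBound k P u (suc bz) → HasBound k P z bz → R₀ i u z →
                     Undominated z → Undominated u
  undominated-pred hu hz r undom-z y (by , bu , hy , hu′ , bu<by , y∼u) with bound-unique hu′ hu
  undominated-pred hu hz r undom-z y (suc by , _ , hy , _ , s≤s bz<by , (_ , _ , back)) | refl =
    let y′ , ry′ , y′∼z = back _ _ r in
    ¬¬-bound-after-step hy ry′ λ (by′ , hy′ , by≤by′) →
      undom-z y′ (≻-intro hy′ hz (<-≤-trans bz<by by≤by′) y′∼z ≤-refl)

  bisimilar-max-bound≤ : ∀ {x bx y by} → InMax k P x bx → InMax k P y by → Bisim bx M x M y → bx ≤ by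
  bisimilar-max-bound≤ (hx , _) (hy , undom-y) x∼y =
    ≮⇒≥ λ by<bx → undom-y _ (≻-intro hx hy by<bx x∼y (<⇒≤ by<bx))

  max-edge-bound≤ : ∀ {x bx y by z i} → InMax k P x bx → InMax k P y by → R₀ i x z →
                    Bisim (bx ∸ 1) M y M z → 0 < bx → bx ≤ suc by
  max-edge-bound≤ {bx = suc b} (hx , _) (hy , undom-y) r y∼z _ =
    ≮⇒≥ λ 1+by<1+b → ¬¬-bound-after-step hx r λ (bz , hz , b≤bz) →
      let by<b = ≤-pred 1+by<1+b in
      undom-y _ (≻-intro hz hy (<-≤-trans by<b b≤bz) (Bisim-sym b y∼z) (<⇒≤ by<b))

module ContractionPaths {ni n : ℕ} (k : ℕ) (R₀ : Fin ni → Fin n → Fin n → Set)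
                        (V₀ : ℕ → Fin n → Set) (wd : Fin n) where
  open Contraction k R₀ V₀ wd
  open MaxWorlds k R₀ V₀ wd

  M′ : Model ni (lsuc 0ℓ) 0ℓ
  M′ = model contraction

  Represents : (Fin n → Set) → Fin n → ℕ → Set
  Represents C x bx = InMax k P x bx × SameSet C (Class M bx x)

  represents-bound≤ : ∀ {C D x bx y by} → Represents C x bx → Represents D y by → SameSet C D → bx ≤ by
  represents-bound≤ {y = y} {by = by} (mx , C≈x) (my , D≈y) C≈D =
    bisimilar-max-bound≤ mx my (to (C≈x y) (from (C≈D y) (from (D≈y y) (Bisim-refl by y))))

  contraction-path-bound≤ : ∀ m {C D x bx y by} → Path M′ C D m →
                            Represents (proj₁ C) x bx → Represents (proj₁ D) y by → bx ≤ by + m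
  contraction-path-bound≤ zero {by = by} (lift C≈D) rC rD =
    ≤-trans (represents-bound≤ rC rD C≈D) (m≤m+n by 0)
  contraction-path-bound≤ (suc m) {bx = bx} {by = by}
      (i , E , (x′ , bx′ , y′ , by′ , mx′ , my′ , C≈x′ , E≈y′ , z , (r , y′∼z) , 0<bx′) , p) rC rD = begin
    bx          ≤⟨ represents-bound≤ rC (mx′ , C≈x′) (λ _ → ⇔-id _) ⟩
    bx′         ≤⟨ max-edge-bound≤ mx′ my′ r y′∼z 0<bx′ ⟩
    suc by′     ≤⟨ s≤s (contraction-path-bound≤ m p (my′ , E≈y′) rD) ⟩
    suc (by + m) ≡⟨ +-suc by m ⟨
    by + suc m  ∎
    where open ≤-Reasoning

  R′-respˡ : ∀ {i C D E} → C ≈' D → R' i D E → R' i C E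
  R′-respˡ C≈D (x , bx , y , by , mx , my , D≈x , rest) =
    x , bx , y , by , mx , my , (λ v → D≈x v ⇔-∘ C≈D v) , rest

  path-snoc′ : ∀ {C D E i} m → Path M′ C D m → R' i D E → Path M′ C E (suc m)
  path-snoc′ = path-snoc {M = M′} (λ _ → ⇔-id _) (λ {i} {C} {D} {E} → R′-respˡ {i} {C} {D} {E})

  shortest-path-contracts : ∀ m {x bx} (depth : IsDepth P x m) (e : m + bx ≡ k) (undom : Undominated x) →
                            Path M′ (root contraction) (classOf x bx ((m , depth , e) , undom)) m
  shortest-path-contracts zero (lift refl , _) refl _ = lift λ _ → ⇔-id _
  shortest-path-contracts (suc m) {x} {bx} (p , shortest) e undom with path-unsnocᴹ m p
  ... | v , i , p′ , r = path-snoc′ m (shortest-path-contracts m depth-v e-v undom-v) edge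
    where
      depth-v : IsDepth P v m
      depth-v = p′ , λ m′ m′<m q → shortest (suc m′) (s≤s m′<m) (path-snocᴹ m′ q r)
      e-v : m + suc bx ≡ k
      e-v = trans (+-suc m bx) e
      hx : HasBound k P x bx
      hx = suc m , (p , shortest) , e
      hv : HasBound k P v (suc bx)
      hv = m , depth-v , e-v
      undom-v : Undominated v
      undom-v = undominated-pred hv hx r undom
      edge : R' i (classOf v (suc bx) (hv , undom-v)) (classOf x bx (hx , undom))
      edge = v , suc bx , x , bx , (hv , undom-v) , (hx , undom) , (λ _ → ⇔-id _) , (λ _ → ⇔-id _)
           , x , (r , Bisim-refl bx x) , s≤s z≤n

lemma4p2 : ∀ {ni n : ℕ} (k : ℕ)
             (R : Fin ni → Fin n → Fin n → Set) (V : ℕ → Fin n → Set) (wd : Fin n)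
             (x : Fin n) (bx : ℕ) (mx : InMax k (finPointed R V wd) x bx) →
             HasBound k (Contraction.contraction k R V wd) (Contraction.classOf k R V wd x bx mx) bx
lemma4p2 k R V wd x bx mx@((dx , depth , ex) , undom) =
  dx , (shortest-path-contracts dx depth ex undom , no-shorter) , ex
  where
    open Contraction k R V wd
    open ContractionPaths k R V wd
    no-shorter : ∀ m → m < dx → ¬ Path M′ (root contraction) (classOf x bx mx) m
    no-shorter m m<dx q =
      <⇒≱ m<dx (depth≤ ex (contraction-path-bound≤ m q (root-max , λ _ → ⇔-id _) (mx , λ _ → ⇔-id _)))
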